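{- Let $G_1$ and $G_2$ be finite simple undirected graphs, and let $G_1\wedge G_2$ denote their corona. Let $m_1=\max(\operatorname{nlcw}(G_1),\operatorname{nlcw}(G_2))$ and $m_2=\max(\operatorname{cw}(G_1),\operatorname{cw}(G_2))$. Then \[m_1\le \operatorname{nlcw}(G_1\wedge G_2)\le m_1+1\quad\text{and}\quad m_2\le \operatorname{cw}(G_1\wedge G_2)\le m_2+1.\]
   Context: Corona: $G_1\wedge G_2$ is the disjoint union of one copy of $G_1$ and $|V_{G_1}|$ copies of $G_2$, where additionally the $i$-th vertex of the copy of $G_1$ is joined by edges to all vertices of the $i$-th copy of $G_2$ (a bijection between vertices of $G_1$ and copies of $G_2$). Clique-width: for a positive integer $k$, $\mathrm{CW}_k$ is the smallest class of graphs whose vertices carry labels from $\{1,\dots,k\}$ that contains every single-vertex graph with any label and is closed under: disjoint union of two vertex-disjoint labeled graphs; relabeling $\rho_{a\to b}$ for $a\neq b$ (every vertex labeled $a$ gets label $b$); and $\eta_{a,b}$ for $a\neq b$ (add all edges between vertices labeled $a$ and vertices labeled $b$). $\operatorname{cw}(G)$ is the least $k$ such that some labeling of $G$ lies in $\mathrm{CW}_k$. NLC-width: $\mathrm{NLC}_k$ is the smallest class of labeled graphs (labels in $\{1,\dots,k\}$) containing every single-vertex graph with any label and closed under: $G\times_S J$ for $S\subseteq\{1,\dots,k\}^2$ (disjoint union of vertex-disjoint $G$ and $J$ plus all edges $\{u,v\}$, $u\in V_G$, $v\in V_J$, $(\mathrm{lab}(u),\mathrm{lab}(v))\in S$); and $\circ_R$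 for $R:\{1,\dots,k\}\to\{1,\dots,k\}$ (each label $a$ replaced by $R(a)$). $\operatorname{nlcw}(G)$ is the least $k$ such that some labeling of $G$ lies in $\mathrm{NLC}_k$. -}

module Defs where

open import Data.Nat using (ℕ; _+_; _*_)
open import Data.Bool using (Bool; true; false; _∧_; _∨_; if_then_else_)
open import Data.Fin using (Fin; splitAt; remQuot; _≟_)
open import Data.Sum using (_⊎_; inj₁; inj₂)
open import Data.Product using (Σ; _×_; _,_)
open import Relation.Nullary.Decidable using (⌊_⌋)
open import Relation.Binary.PropositionalEquality using (_≡_; _≢_)
open import Function.Bundles using (_↔_; Inverse)

record Graph : Set where
  constructor mkGraph
  field
    V   : ℕ
    adj : Fin V → Fin V → Bool
open Graph public

IsSimple : Graph → Set
IsSimple G = (∀ u v → adj G u v ≡ adj G v u) × (∀ u → adj G u u ≡ false)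

_==_ : ∀ {n} → Fin n → Fin n → Bool
a == b = ⌊ a ≟ b ⌋

-- Corona G₁ ∧ G₂ : vertices Fin (n₁ + n₁ * n₂); the left block is the copy
-- of G₁, the right block vertex (i , j) (via remQuot) is vertex j of the
-- i-th copy of G₂, which is attached to vertex i of G₁.

corona : Graph → Graph → Graph
corona G₁ G₂ = mkGraph (n₁ + n₁ * n₂) A
  where
  n₁ = V G₁
  n₂ = V G₂
  A : Fin (n₁ + n₁ * n₂) → Fin (n₁ + n₁ * n₂) → Bool
  A u v with splitAt n₁ u | splitAt n₁ v
  ... | inj₁ i | inj₁ i' = adj G₁ i i'
  ... | inj₁ i | inj₂ q with remQuot {n₁} n₂ q
  ...   | (i' , _) = i == i'
  A u v | inj₂ p | inj₁ i' with remQuot {n₁} n₂ p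
  ...   | (i , _) = i == i'
  A u v | inj₂ p | inj₂ q with remQuot {n₁} n₂ p | remQuot {n₁} n₂ q
  ...   | (i , j) | (i' , j') = (i == i') ∧ adj G₂ j j'

record LGraph (k n : ℕ) : Set where
  field
    ladj : Fin n → Fin n → Bool
    lab  : Fin n → Fin k
open LGraph public

single : ∀ {k} → Fin k → LGraph k 1
single a = record { ladj = λ _ _ → false ; lab = λ _ → a }

unionWith : ∀ {k m n} → (Fin k → Fin k → Bool) → LGraph k m → LGraph k n → LGraph k (m + n)
unionWith {k} {m} {n} cross G J = record { ladj = A ; lab = L }
  where
  L : Fin (m + n) → Fin k
  L u with splitAt m u
  ... | inj₁ x = lab G x
  ... | inj₂ y = lab J y
  A : Fin (m + n) → Fin (m + n) → Bool
  A u v with splitAt m u | splitAt m v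
  ... | inj₁ x | inj₁ x' = ladj G x x'
  ... | inj₂ y | inj₂ y' = ladj J y y'
  ... | inj₁ x | inj₂ y  = cross (lab G x) (lab J y)
  ... | inj₂ y | inj₁ x  = cross (lab G x) (lab J y)

relabel : ∀ {k n} → (Fin k → Fin k) → LGraph k n → LGraph k n
relabel R G = record { ladj = ladj G ; lab = λ v → R (lab G v) }

data CWExpr (k : ℕ) : ℕ → Set where
  cw-vtx : Fin k → CWExpr k 1
  cw-⊕   : ∀ {m n} → CWExpr k m → CWExpr k n → CWExpr k (m + n)
  cw-ρ   : ∀ {n} (a b : Fin k) → a ≢ b → CWExpr k n → CWExpr k n
  cw-η   : ∀ {n} (a b : Fin k) → a ≢ b → CWExpr k n → CWExpr k n

evalCW : ∀ {k n} → CWExpr k n → LGraph k n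
evalCW (cw-vtx a) = single a
evalCW (cw-⊕ e f) = unionWith (λ _ _ → false) (evalCW e) (evalCW f)
evalCW (cw-ρ a b _ e) = relabel (λ c → if c == a then b else c) (evalCW e)
evalCW (cw-η a b _ e) = record
  { ladj = λ u v → ladj G u v ∨ ((lab G u == a ∧ lab G v == b) ∨ (lab G u == b ∧ lab G v == a))
  ; lab  = lab G }
  where G = evalCW e

data NLCExpr (k : ℕ) : ℕ → Set where
  nlc-vtx : Fin k → NLCExpr k 1
  nlc-×   : ∀ {m n} → (Fin k → Fin k → Bool) → NLCExpr k m → NLCExpr k n → NLCExpr k (m + n)
  nlc-∘   : ∀ {n} → (Fin k → Fin k) → NLCExpr k n → NLCExpr k n

evalNLC : ∀ {k n} → NLCExpr k n → LGraph k n
evalNLC (nlc-vtx a) = single a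
evalNLC (nlc-× S e f) = unionWith S (evalNLC e) (evalNLC f)
evalNLC (nlc-∘ R e) = relabel R (evalNLC e)

Represents : ∀ {k n} → LGraph k n → Graph → Set
Represents {k} {n} H G =
  Σ (Fin n ↔ Fin (V G)) λ f →
    ∀ u v → ladj H u v ≡ adj G (Inverse.to f u) (Inverse.to f v)

InCW : ℕ → Graph → Set
InCW k G = Σ ℕ λ n → Σ (CWExpr k n) λ e → Represents (evalCW e) G

InNLC : ℕ → Graph → Set
InNLC k G = Σ ℕ λ n → Σ (NLCExpr k n) λ e → Represents (evalNLC e) G

open import Data.Nat using (_≤_)

IsCW : Graph → ℕ → Set
IsCW G k = InCW k G × (∀ j → InCW j G → k ≤ j)

IsNLCW : Graph → ℕ → Set
IsNLCW G k = InNLC k G × (∀ j → InNLC j G → k ≤ j)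

-- G₁ is an induced subgraph of G₁ ∧ G₂, and so is every copy of G₂. Restricting a CW- or
-- NLC-expression to a set of vertices (dropping the leaves outside it) yields an expression of
-- the same width for the induced subgraph, so both widths of the corona are at least m.
-- Conversely, take width-m expressions for G₁ and G₂, shift the labels of the G₁-expression up
-- by one and replace each leaf of label a by a cone: a vertex of label a + 1 joined to a copy of
-- G₂ all of whose vertices carry the new label 0. The shifted operations never involve label 0,
-- so each copy of G₂ stays joined to its own apex only, and the result has width m + 1.

{-# OPTIONS --safe #-}
module Submission where

open import Defs
open import Data.Bool using (Bool; true; false; _∧_; _∨_; if_then_else_)
open import Data.Bool.Properties using (∧-zeroʳ; ∨-identityʳ)
open import Data.Fin using (Fin; zero; suc; splitAt; _↑ˡ_; _↑ʳ_; remQuot; combine; lift; _≟_)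
open import Data.Fin.Properties using (suc-injective; ↑ˡ-injective; ↑ʳ-injective; splitAt-↑ˡ; splitAt-↑ʳ; splitAt⁻¹-↑ˡ; splitAt⁻¹-↑ʳ; +↔⊎; remQuot-combine; combine-remQuot; any?)
open import Data.List using (List; []; _∷_; allFin)
open import Data.List.Membership.Propositional using (_∈_)
open import Data.List.Membership.Propositional.Properties using (∈-allFin)
open import Data.List.Relation.Unary.Any using (here; there)
open import Data.Maybe using (Maybe; just; nothing; maybe′)
open import Data.Maybe.Properties using (just-injective)
open import Data.Nat using (ℕ; suc; _+_; _*_; _≤_; _⊔_)
open import Data.Nat.Properties using (m≤n⇒∃[o]m+o≡n; ⊔-lub; m≤m⊔n; m≤n⊔m)
open import Data.Product using (Σ; ∃; _×_; _,_; proj₁; proj₂; map₁; map₂)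
open import Data.Product.Function.NonDependent.Propositional using (_×-↔_)
open import Data.Sum using (inj₁; inj₂; [_,_]′)
open import Data.Sum.Function.Propositional using (_⊎-↣_; _⊎-↔_)
open import Function using (_∘_; id; const; flip)
open import Function.Bundles using (_↔_; _↣_; Inverse; Injection; mk↔ₛ′; mk↣)
open import Function.Construct.Composition using (_↣-∘_; _↔-∘_)
open import Function.Construct.Identity using (↣-id)
open import Function.Definitions using (Injective)
open import Function.Properties.Inverse using (↔⇒↣; ↔-refl; ↔-sym; ↔-trans)
open import Function.Related.TypeIsomorphisms using (×-distribʳ-⊎)
open import Level using (0ℓ)
open import Relation.Binary.PropositionalEquality
open import Relation.Nullary using (¬_; yes; no; contradiction)
open import Relation.Unary using (Pred; Decidable)

==-refl : ∀ {n} (a : Fin n) → (a == a) ≡ true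
==-refl a with a ≟ a
... | yes _   = refl
... | no a≢a = contradiction refl a≢a

==-≢ : ∀ {n} {a b : Fin n} → a ≢ b → (a == b) ≡ false
==-≢ {a = a} {b} a≢b with a ≟ b
... | yes a≡b = contradiction a≡b a≢b
... | no _    = refl

==-map-injective : ∀ {m n} {f : Fin m → Fin n} → Injective _≡_ _≡_ f →
                   ∀ a b → (f a == f b) ≡ (a == b)
==-map-injective {f = f} f-inj a b with a ≟ b
... | yes refl = ==-refl (f a)
... | no a≢b   = ==-≢ (a≢b ∘ f-inj)

↑ˡ≢↑ʳ : ∀ {m n} (i : Fin m) (j : Fin n) → i ↑ˡ n ≢ m ↑ʳ j
↑ˡ≢↑ʳ {m} {n} i j eq
  with () ← trans (sym (splitAt-↑ˡ m i n)) (trans (cong (splitAt m) eq) (splitAt-↑ʳ m n j))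

↑-elim : ∀ {m n ℓ} (Q : Fin (m + n) → Set ℓ) →
         (∀ i → Q (i ↑ˡ n)) → (∀ j → Q (m ↑ʳ j)) → ∀ u → Q u
↑-elim {m} Q left right u with splitAt m u in eq
... | inj₁ i = subst Q (splitAt⁻¹-↑ˡ eq) (left i)
... | inj₂ j = subst Q (splitAt⁻¹-↑ʳ eq) (right j)

module _ {k m n : ℕ} (c : Fin k → Fin k → Bool) (G : LGraph k m) (J : LGraph k n) where

  unionWith-ˡˡ : ∀ i i' → ladj (unionWith c G J) (i ↑ˡ n) (i' ↑ˡ n) ≡ ladj G i i'
  unionWith-ˡˡ i i' rewrite splitAt-↑ˡ m i n | splitAt-↑ˡ m i' n = refl

  unionWith-ʳʳ : ∀ j j' → ladj (unionWith c G J) (m ↑ʳ j) (m ↑ʳ j') ≡ ladj J j j'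
  unionWith-ʳʳ j j' rewrite splitAt-↑ʳ m n j | splitAt-↑ʳ m n j' = refl

  unionWith-ˡʳ : ∀ i j → ladj (unionWith c G J) (i ↑ˡ n) (m ↑ʳ j) ≡ c (lab G i) (lab J j)
  unionWith-ˡʳ i j rewrite splitAt-↑ˡ m i n | splitAt-↑ʳ m n j = refl

  unionWith-ʳˡ : ∀ j i → ladj (unionWith c G J) (m ↑ʳ j) (i ↑ˡ n) ≡ c (lab G i) (lab J j)
  unionWith-ʳˡ j i rewrite splitAt-↑ˡ m i n | splitAt-↑ʳ m n j = refl

  unionWith-labˡ : ∀ i → lab (unionWith c G J) (i ↑ˡ n) ≡ lab G i
  unionWith-labˡ i rewrite splitAt-↑ˡ m i n = refl

  unionWith-labʳ : ∀ j → lab (unionWith c G J) (m ↑ʳ j) ≡ lab J j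
  unionWith-labʳ j rewrite splitAt-↑ʳ m n j = refl

record Pullback {k k' n N} (ι : Fin k → Fin k') (t : Fin N → Fin n)
                (H : LGraph k n) (E : LGraph k' N) : Set where
  field
    adj-pullback : ∀ w w' → ladj E w w' ≡ ladj H (t w) (t w')
    lab-pullback : ∀ w → lab E w ≡ ι (lab H (t w))
open Pullback

addEdges : ∀ {k n} → Fin k → Fin k → LGraph k n → LGraph k n
addEdges a b G = record
  { ladj = λ u v → ladj G u v ∨ ((lab G u == a ∧ lab G v == b) ∨ (lab G u == b ∧ lab G v == a))
  ; lab  = lab G }

replace : ∀ {k} → Fin k → Fin k → Fin k → Fin k
replace a b c = if c == a then b else c

replace-map-injective : ∀ {k k'} {ι : Fin k → Fin k'} → Injective _≡_ _≡_ ι →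
                        ∀ a b c → replace (ι a) (ι b) (ι c) ≡ ι (replace a b c)
replace-map-injective ι-injective a b c rewrite ==-map-injective ι-injective c a with c == a
... | true  = refl
... | false = refl

module _ {k k' : ℕ} {ι : Fin k → Fin k'} where

  pullback-single : ∀ a → Pullback ι id (single a) (single (ι a))
  pullback-single a = record { adj-pullback = λ _ _ → refl ; lab-pullback = λ _ → refl }

  pullback-union : ∀ {m n N₁ N₂} {c c'} {H₁ : LGraph k m} {H₂ : LGraph k n}
                   {E₁ : LGraph k' N₁} {E₂ : LGraph k' N₂} {t₁ t₂} {T : Fin (N₁ + N₂) → Fin (m + n)} →
                   (∀ i → T (i ↑ˡ N₂) ≡ t₁ i ↑ˡ n) → (∀ j → T (N₁ ↑ʳ j) ≡ m ↑ʳ t₂ j) →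
                   (∀ a b → c' (ι a) (ι b) ≡ c a b) →
                   Pullback ι t₁ H₁ E₁ → Pullback ι t₂ H₂ E₂ →
                   Pullback ι T (unionWith c H₁ H₂) (unionWith c' E₁ E₂)
  pullback-union {m} {n} {N₁} {N₂} {c} {c'} {H₁} {H₂} {E₁} {E₂} {t₁} {t₂} {T} Tˡ Tʳ c'-ι p₁ p₂ =
    record { adj-pullback = ↑-elim _ (λ i → ↑-elim _ (ˡˡ i) (ˡʳ i)) (λ j → ↑-elim _ (ʳˡ j) (ʳʳ j))
           ; lab-pullback = ↑-elim _ labˡ labʳ }
    where
    open ≡-Reasoning
    H = unionWith c H₁ H₂
    E = unionWith c' E₁ E₂

    ˡˡ : ∀ i i' → ladj E (i ↑ˡ N₂) (i' ↑ˡ N₂) ≡ ladj H (T (i ↑ˡ N₂)) (T (i' ↑ˡ N₂))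
    ˡˡ i i' = begin
      ladj E (i ↑ˡ N₂) (i' ↑ˡ N₂)         ≡⟨ unionWith-ˡˡ c' E₁ E₂ i i' ⟩
      ladj E₁ i i'                       ≡⟨ adj-pullback p₁ i i' ⟩
      ladj H₁ (t₁ i) (t₁ i')              ≡⟨ unionWith-ˡˡ c H₁ H₂ (t₁ i) (t₁ i') ⟨
      ladj H (t₁ i ↑ˡ n) (t₁ i' ↑ˡ n)     ≡⟨ cong₂ (ladj H) (Tˡ i) (Tˡ i') ⟨
      ladj H (T (i ↑ˡ N₂)) (T (i' ↑ˡ N₂)) ∎

    ʳʳ : ∀ j j' → ladj E (N₁ ↑ʳ j) (N₁ ↑ʳ j') ≡ ladj H (T (N₁ ↑ʳ j)) (T (N₁ ↑ʳ j'))
    ʳʳ j j' = begin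
      ladj E (N₁ ↑ʳ j) (N₁ ↑ʳ j')         ≡⟨ unionWith-ʳʳ c' E₁ E₂ j j' ⟩
      ladj E₂ j j'                       ≡⟨ adj-pullback p₂ j j' ⟩
      ladj H₂ (t₂ j) (t₂ j')              ≡⟨ unionWith-ʳʳ c H₁ H₂ (t₂ j) (t₂ j') ⟨
      ladj H (m ↑ʳ t₂ j) (m ↑ʳ t₂ j')     ≡⟨ cong₂ (ladj H) (Tʳ j) (Tʳ j') ⟨
      ladj H (T (N₁ ↑ʳ j)) (T (N₁ ↑ʳ j')) ∎

    cross : ∀ i j → c' (lab E₁ i) (lab E₂ j) ≡ c (lab H₁ (t₁ i)) (lab H₂ (t₂ j))
    cross i j = trans (cong₂ c' (lab-pullback p₁ i) (lab-pullback p₂ j)) (c'-ι _ _)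

    ˡʳ : ∀ i j → ladj E (i ↑ˡ N₂) (N₁ ↑ʳ j) ≡ ladj H (T (i ↑ˡ N₂)) (T (N₁ ↑ʳ j))
    ˡʳ i j = begin
      ladj E (i ↑ˡ N₂) (N₁ ↑ʳ j)          ≡⟨ unionWith-ˡʳ c' E₁ E₂ i j ⟩
      c' (lab E₁ i) (lab E₂ j)            ≡⟨ cross i j ⟩
      c (lab H₁ (t₁ i)) (lab H₂ (t₂ j))   ≡⟨ unionWith-ˡʳ c H₁ H₂ (t₁ i) (t₂ j) ⟨
      ladj H (t₁ i ↑ˡ n) (m ↑ʳ t₂ j)      ≡⟨ cong₂ (ladj H) (Tˡ i) (Tʳ j) ⟨
      ladj H (T (i ↑ˡ N₂)) (T (N₁ ↑ʳ j))  ∎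

    ʳˡ : ∀ j i → ladj E (N₁ ↑ʳ j) (i ↑ˡ N₂) ≡ ladj H (T (N₁ ↑ʳ j)) (T (i ↑ˡ N₂))
    ʳˡ j i = begin
      ladj E (N₁ ↑ʳ j) (i ↑ˡ N₂)          ≡⟨ unionWith-ʳˡ c' E₁ E₂ j i ⟩
      c' (lab E₁ i) (lab E₂ j)            ≡⟨ cross i j ⟩
      c (lab H₁ (t₁ i)) (lab H₂ (t₂ j))   ≡⟨ unionWith-ʳˡ c H₁ H₂ (t₂ j) (t₁ i) ⟨
      ladj H (m ↑ʳ t₂ j) (t₁ i ↑ˡ n)      ≡⟨ cong₂ (ladj H) (Tʳ j) (Tˡ i) ⟨
      ladj H (T (N₁ ↑ʳ j)) (T (i ↑ˡ N₂))  ∎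

    labˡ : ∀ i → lab E (i ↑ˡ N₂) ≡ ι (lab H (T (i ↑ˡ N₂)))
    labˡ i = begin
      lab E (i ↑ˡ N₂)             ≡⟨ unionWith-labˡ c' E₁ E₂ i ⟩
      lab E₁ i                    ≡⟨ lab-pullback p₁ i ⟩
      ι (lab H₁ (t₁ i))           ≡⟨ cong ι (unionWith-labˡ c H₁ H₂ (t₁ i)) ⟨
      ι (lab H (t₁ i ↑ˡ n))       ≡⟨ cong (ι ∘ lab H) (Tˡ i) ⟨
      ι (lab H (T (i ↑ˡ N₂)))     ∎

    labʳ : ∀ j → lab E (N₁ ↑ʳ j) ≡ ι (lab H (T (N₁ ↑ʳ j)))
    labʳ j = begin
      lab E (N₁ ↑ʳ j)             ≡⟨ unionWith-labʳ c' E₁ E₂ j ⟩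
      lab E₂ j                    ≡⟨ lab-pullback p₂ j ⟩
      ι (lab H₂ (t₂ j))           ≡⟨ cong ι (unionWith-labʳ c H₁ H₂ (t₂ j)) ⟨
      ι (lab H (m ↑ʳ t₂ j))       ≡⟨ cong (ι ∘ lab H) (Tʳ j) ⟨
      ι (lab H (T (N₁ ↑ʳ j)))     ∎

  pullback-relabel : ∀ {n N} {H : LGraph k n} {E : LGraph k' N} {t} R R' →
                     (∀ a → R' (ι a) ≡ ι (R a)) →
                     Pullback ι t H E → Pullback ι t (relabel R H) (relabel R' E)
  pullback-relabel R R' R'-ι p = record
    { adj-pullback = adj-pullback p
    ; lab-pullback = λ w → trans (cong R' (lab-pullback p w)) (R'-ι _) }

  pullback-addEdges : ∀ {n N} {H : LGraph k n} {E : LGraph k' N} {t} → Injective _≡_ _≡_ ι →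
                      ∀ a b → Pullback ι t H E → Pullback ι t (addEdges a b H) (addEdges (ι a) (ι b) E)
  pullback-addEdges {H = H} {E} {t} ι-injective a b p = record
    { adj-pullback = adjacency ; lab-pullback = lab-pullback p }
    where
    adjacency : ∀ w w' → ladj (addEdges (ι a) (ι b) E) w w' ≡ ladj (addEdges a b H) (t w) (t w')
    adjacency w w' rewrite adj-pullback p w w' | lab-pullback p w | lab-pullback p w'
                   | ==-map-injective ι-injective (lab H (t w)) a | ==-map-injective ι-injective (lab H (t w')) b
                   | ==-map-injective ι-injective (lab H (t w)) b | ==-map-injective ι-injective (lab H (t w')) a = refl

represents-pullback : ∀ {k k' n} {ι : Fin k → Fin k'} {H : LGraph k n} {E : LGraph k' n} {G} →
                      Pullback ι id H E → Represents H G → Represents E G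
represents-pullback p (f , f-adj) = f , λ u v → trans (adj-pullback p u v) (f-adj u v)

-- Relabelling expressions into more labels

module _ {k k' : ℕ} {ι : Fin k → Fin k'} (ι-injective : Injective _≡_ _≡_ ι) where

  liftCW : ∀ {n} → CWExpr k n → CWExpr k' n
  liftCW (cw-vtx a)       = cw-vtx (ι a)
  liftCW (cw-⊕ e f)       = cw-⊕ (liftCW e) (liftCW f)
  liftCW (cw-ρ a b a≢b e) = cw-ρ (ι a) (ι b) (a≢b ∘ ι-injective) (liftCW e)
  liftCW (cw-η a b a≢b e) = cw-η (ι a) (ι b) (a≢b ∘ ι-injective) (liftCW e)

  liftCW-pullback : ∀ {n} (e : CWExpr k n) → Pullback ι id (evalCW e) (evalCW (liftCW e))
  liftCW-pullback (cw-vtx a)     = pullback-single a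
  liftCW-pullback (cw-⊕ e f)     =
    pullback-union (λ _ → refl) (λ _ → refl) (λ _ _ → refl) (liftCW-pullback e) (liftCW-pullback f)
  liftCW-pullback (cw-ρ a b _ e) =
    pullback-relabel (replace a b) (replace (ι a) (ι b)) (replace-map-injective ι-injective a b) (liftCW-pullback e)
  liftCW-pullback (cw-η a b _ e) = pullback-addEdges ι-injective a b (liftCW-pullback e)

module _ {k k' : ℕ} {ι : Fin k → Fin k'} (π : Fin k' → Maybe (Fin k)) (π-ι : ∀ a → π (ι a) ≡ just a) where

  liftRel : (Fin k → Fin k → Bool) → Fin k' → Fin k' → Bool
  liftRel S x y = maybe′ (λ a → maybe′ (S a) false (π y)) false (π x)

  liftMap : (Fin k → Fin k) → Fin k' → Fin k'
  liftMap R x = maybe′ (ι ∘ R) x (π x)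

  liftNLC : ∀ {n} → NLCExpr k n → NLCExpr k' n
  liftNLC (nlc-vtx a)   = nlc-vtx (ι a)
  liftNLC (nlc-× S e f) = nlc-× (liftRel S) (liftNLC e) (liftNLC f)
  liftNLC (nlc-∘ R e)   = nlc-∘ (liftMap R) (liftNLC e)

  liftNLC-pullback : ∀ {n} (e : NLCExpr k n) → Pullback ι id (evalNLC e) (evalNLC (liftNLC e))
  liftNLC-pullback (nlc-vtx a)   = pullback-single a
  liftNLC-pullback (nlc-× S e f) =
    pullback-union (λ _ → refl) (λ _ → refl) liftRel-ι (liftNLC-pullback e) (liftNLC-pullback f)
    where
    liftRel-ι : ∀ a b → liftRel S (ι a) (ι b) ≡ S a b
    liftRel-ι a b rewrite π-ι a | π-ι b = refl
  liftNLC-pullback (nlc-∘ R e)   = pullback-relabel R (liftMap R) liftMap-ι (liftNLC-pullback e)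
    where
    liftMap-ι : ∀ a → liftMap R (ι a) ≡ ι (R a)
    liftMap-ι a rewrite π-ι a = refl

InCW-mono : ∀ {k k'} G → k ≤ k' → InCW k G → InCW k' G
InCW-mono G k≤k' (n , e , rep) with d , refl ← m≤n⇒∃[o]m+o≡n k≤k' =
  n , liftCW ι-injective e , represents-pullback {G = G} (liftCW-pullback ι-injective e) rep
  where
  ι-injective : Injective _≡_ _≡_ (_↑ˡ d)
  ι-injective = ↑ˡ-injective d _ _

InNLC-mono : ∀ {k k'} G → k ≤ k' → InNLC k G → InNLC k' G
InNLC-mono {k} G k≤k' (n , e , rep) with d , refl ← m≤n⇒∃[o]m+o≡n k≤k' =
  n , liftNLC π π-ι e , represents-pullback {G = G} (liftNLC-pullback π π-ι e) rep
  where
  π : Fin (k + d) → Maybe (Fin k)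
  π x = [ just , const nothing ]′ (splitAt k x)
  π-ι : ∀ a → π (a ↑ˡ d) ≡ just a
  π-ι a = cong [ just , const nothing ]′ (splitAt-↑ˡ k a d)

-- Induced subgraphs

record InducedSubgraph (G C : Graph) : Set where
  field
    embed           : Fin (V G) → Fin (V C)
    embed-injective : Injective _≡_ _≡_ embed
    embed-adj       : ∀ x y → adj C (embed x) (embed y) ≡ adj G x y

record Restriction {k n N} (H : LGraph k n) (P : Pred (Fin n) 0ℓ) (E : LGraph k N) : Set where
  field
    inclusion          : Fin N ↣ Fin n
  open Injection inclusion public using () renaming (to to include; injective to include-injective)
  field
    include-∈          : ∀ w → P (include w)
    include-onto       : ∀ u → P u → ∃ λ w → include w ≡ u
    include-pullback   : Pullback id include H E
open Restriction

-- Every expression has a vertex, so restricting to an empty vertex set leaves no expression.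
data Restricted {k n} (Ex : ℕ → Set) (ev : ∀ {N} → Ex N → LGraph k N)
                (H : LGraph k n) (P : Pred (Fin n) 0ℓ) : Set where
  empty      : (∀ u → ¬ P u) → Restricted Ex ev H P
  restricted : ∀ {N} (e : Ex N) → Restriction H P (ev e) → Restricted Ex ev H P

module _ {k : ℕ} where

  restriction-single : ∀ {a : Fin k} {P} → P zero → Restriction (single a) P (single a)
  restriction-single {a} p = record
    { inclusion        = ↣-id _
    ; include-∈        = λ { zero → p }
    ; include-onto     = λ u _ → u , refl
    ; include-pullback = pullback-single a }

  module _ {m n : ℕ} {c : Fin k → Fin k → Bool} {H₁ : LGraph k m} {H₂ : LGraph k n} {P : Pred (Fin (m + n)) 0ℓ} where

    restriction-union : ∀ {N₁ N₂} {E₁ : LGraph k N₁} {E₂ : LGraph k N₂} →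
                        Restriction H₁ (P ∘ (_↑ˡ n)) E₁ → Restriction H₂ (P ∘ (m ↑ʳ_)) E₂ →
                        Restriction (unionWith c H₁ H₂) P (unionWith c E₁ E₂)
    restriction-union {N₁} {N₂} r₁ r₂ = record
      { inclusion        = inclusion₁₂
      ; include-∈        = ↑-elim _ (λ i → subst P (sym (includeˡ i)) (include-∈ r₁ i))
                                    (λ j → subst P (sym (includeʳ j)) (include-∈ r₂ j))
      ; include-onto     = ↑-elim _ (λ x p → let w , eq = include-onto r₁ x p in
                                               w ↑ˡ N₂ , trans (includeˡ w) (cong (_↑ˡ n) eq))
                                    (λ y p → let w , eq = include-onto r₂ y p in
                                               N₁ ↑ʳ w , trans (includeʳ w) (cong (m ↑ʳ_) eq))
      ; include-pullback = pullback-union includeˡ includeʳ (λ _ _ → refl)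
                                          (include-pullback r₁) (include-pullback r₂) }
      where
      inclusion₁₂ : Fin (N₁ + N₂) ↣ Fin (m + n)
      inclusion₁₂ = ↔⇒↣ (↔-sym +↔⊎) ↣-∘ ((inclusion r₁ ⊎-↣ inclusion r₂) ↣-∘ ↔⇒↣ +↔⊎)
      includeˡ : ∀ i → Injection.to inclusion₁₂ (i ↑ˡ N₂) ≡ include r₁ i ↑ˡ n
      includeˡ i rewrite splitAt-↑ˡ N₁ i N₂ = refl
      includeʳ : ∀ j → Injection.to inclusion₁₂ (N₁ ↑ʳ j) ≡ m ↑ʳ include r₂ j
      includeʳ j rewrite splitAt-↑ʳ N₁ N₂ j = refl

    restriction-unionˡ : ∀ {N} {E : LGraph k N} → Restriction H₁ (P ∘ (_↑ˡ n)) E → (∀ j → ¬ P (m ↑ʳ j)) →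
                         Restriction (unionWith c H₁ H₂) P E
    restriction-unionˡ r ∉P = record
      { inclusion        = mk↣ (include-injective r ∘ ↑ˡ-injective n _ _)
      ; include-∈        = include-∈ r
      ; include-onto     = ↑-elim _ (λ x p → let w , eq = include-onto r x p in w , cong (_↑ˡ n) eq)
                                    (λ y p → contradiction p (∉P y))
      ; include-pullback = record
        { adj-pullback = λ w w' → trans (adj-pullback (include-pullback r) w w') (sym (unionWith-ˡˡ c H₁ H₂ _ _))
        ; lab-pullback = λ w → trans (lab-pullback (include-pullback r) w) (sym (unionWith-labˡ c H₁ H₂ _)) } }

    restriction-unionʳ : ∀ {N} {E : LGraph k N} → Restriction H₂ (P ∘ (m ↑ʳ_)) E → (∀ i → ¬ P (i ↑ˡ n)) →
                         Restriction (unionWith c H₁ H₂) P E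
    restriction-unionʳ r ∉P = record
      { inclusion        = mk↣ (include-injective r ∘ ↑ʳ-injective m _ _)
      ; include-∈        = include-∈ r
      ; include-onto     = ↑-elim _ (λ x p → contradiction p (∉P x))
                                    (λ y p → let w , eq = include-onto r y p in w , cong (m ↑ʳ_) eq)
      ; include-pullback = record
        { adj-pullback = λ w w' → trans (adj-pullback (include-pullback r) w w') (sym (unionWith-ʳʳ c H₁ H₂ _ _))
        ; lab-pullback = λ w → trans (lab-pullback (include-pullback r) w) (sym (unionWith-labʳ c H₁ H₂ _)) } }

  module _ {n N : ℕ} {H : LGraph k n} {P : Pred (Fin n) 0ℓ} {E : LGraph k N} (r : Restriction H P E) where

    restriction-relabel : ∀ R → Restriction (relabel R H) P (relabel R E)
    restriction-relabel R = record
      { inclusion        = inclusion r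
      ; include-∈        = include-∈ r
      ; include-onto     = include-onto r
      ; include-pullback = pullback-relabel R R (λ _ → refl) (include-pullback r) }

    restriction-addEdges : ∀ a b → Restriction (addEdges a b H) P (addEdges a b E)
    restriction-addEdges a b = record
      { inclusion        = inclusion r
      ; include-∈        = include-∈ r
      ; include-onto     = include-onto r
      ; include-pullback = pullback-addEdges {ι = id} (λ eq → eq) a b (include-pullback r) }

module _ {k : ℕ} {Ex : ℕ → Set} {ev : ∀ {N} → Ex N → LGraph k N} where

  restricted-union : ∀ {m n} {c} {H₁ : LGraph k m} {H₂ : LGraph k n} {P : Pred (Fin (m + n)) 0ℓ} →
                     (_⊗_ : ∀ {N₁ N₂} → Ex N₁ → Ex N₂ → Ex (N₁ + N₂)) →
                     (∀ {N₁ N₂} (e₁ : Ex N₁) (e₂ : Ex N₂) → ev (e₁ ⊗ e₂) ≡ unionWith c (ev e₁) (ev e₂)) →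
                     Restricted Ex ev H₁ (P ∘ (_↑ˡ n)) → Restricted Ex ev H₂ (P ∘ (m ↑ʳ_)) →
                     Restricted Ex ev (unionWith c H₁ H₂) P
  restricted-union _ _ (empty ∉P₁)        (empty ∉P₂)        = empty (↑-elim _ ∉P₁ ∉P₂)
  restricted-union _ _ (restricted e₁ r₁) (empty ∉P₂)        = restricted e₁ (restriction-unionˡ r₁ ∉P₂)
  restricted-union _ _ (empty ∉P₁)        (restricted e₂ r₂) = restricted e₂ (restriction-unionʳ r₂ ∉P₁)
  restricted-union {P = P} _⊗_ ev-⊗ (restricted e₁ r₁) (restricted e₂ r₂) =
    restricted (e₁ ⊗ e₂) (subst (Restriction _ P) (sym (ev-⊗ e₁ e₂)) (restriction-union r₁ r₂))

restrictCW : ∀ {k n} (e : CWExpr k n) {P : Pred (Fin n) 0ℓ} → Decidable P → Restricted (CWExpr k) evalCW (evalCW e) P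
restrictCW (cw-vtx a) P? with P? zero
... | yes p = restricted (cw-vtx a) (restriction-single p)
... | no ∉P = empty λ { zero → ∉P }
restrictCW (cw-⊕ e f) P? =
  restricted-union cw-⊕ (λ _ _ → refl) (restrictCW e (P? ∘ (_↑ˡ _))) (restrictCW f (P? ∘ (_ ↑ʳ_)))
restrictCW (cw-ρ a b a≢b e) P? with restrictCW e P?
... | empty ∉P       = empty ∉P
... | restricted e' r = restricted (cw-ρ a b a≢b e') (restriction-relabel r (replace a b))
restrictCW (cw-η a b a≢b e) P? with restrictCW e P?
... | empty ∉P       = empty ∉P
... | restricted e' r = restricted (cw-η a b a≢b e') (restriction-addEdges r a b)

restrictNLC : ∀ {k n} (e : NLCExpr k n) {P : Pred (Fin n) 0ℓ} → Decidable P → Restricted (NLCExpr k) evalNLC (evalNLC e) P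
restrictNLC (nlc-vtx a) P? with P? zero
... | yes p = restricted (nlc-vtx a) (restriction-single p)
... | no ∉P = empty λ { zero → ∉P }
restrictNLC (nlc-× S e f) P? =
  restricted-union (nlc-× S) (λ _ _ → refl) (restrictNLC e (P? ∘ (_↑ˡ _))) (restrictNLC f (P? ∘ (_ ↑ʳ_)))
restrictNLC (nlc-∘ R e) P? with restrictNLC e P?
... | empty ∉P       = empty ∉P
... | restricted e' r = restricted (nlc-∘ R e') (restriction-relabel r R)

Expressible : ∀ {k} (Ex : ℕ → Set) → (∀ {n} → Ex n → LGraph k n) → Graph → Set
Expressible Ex ev G = Σ ℕ λ n → Σ (Ex n) λ e → Represents (ev e) G

module _ {k n : ℕ} {H : LGraph k n} {G C : Graph} (G⊆C : InducedSubgraph G C) (rep : Represents H C) where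
  open InducedSubgraph G⊆C
  open Inverse (proj₁ rep)

  restriction-represents : ∀ {N} {E : LGraph k N} → Restriction H (λ u → ∃ λ x → embed x ≡ to u) E → Represents E G
  restriction-represents {N} {E} r = mk↔ₛ′ φ ψ φ∘ψ ψ∘φ , φ-adj
    where
    open ≡-Reasoning

    φ : Fin N → Fin (V G)
    φ w = proj₁ (include-∈ r w)

    embed-φ : ∀ w → embed (φ w) ≡ to (include r w)
    embed-φ w = proj₂ (include-∈ r w)

    ψ-spec : ∀ x → ∃ λ w → include r w ≡ from (embed x)
    ψ-spec x = include-onto r (from (embed x)) (x , sym (strictlyInverseˡ (embed x)))

    ψ : Fin (V G) → Fin N
    ψ = proj₁ ∘ ψ-spec

    φ∘ψ : ∀ x → φ (ψ x) ≡ x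
    φ∘ψ x = embed-injective (begin
      embed (φ (ψ x))        ≡⟨ embed-φ (ψ x) ⟩
      to (include r (ψ x))   ≡⟨ cong to (proj₂ (ψ-spec x)) ⟩
      to (from (embed x))    ≡⟨ strictlyInverseˡ (embed x) ⟩
      embed x                ∎)

    ψ∘φ : ∀ w → ψ (φ w) ≡ w
    ψ∘φ w = include-injective r (begin
      include r (ψ (φ w))    ≡⟨ proj₂ (ψ-spec (φ w)) ⟩
      from (embed (φ w))     ≡⟨ cong from (embed-φ w) ⟩
      from (to (include r w)) ≡⟨ strictlyInverseʳ (include r w) ⟩
      include r w            ∎)

    φ-adj : ∀ u v → ladj E u v ≡ adj G (φ u) (φ v)
    φ-adj u v = begin
      ladj E u v                                  ≡⟨ adj-pullback (include-pullback r) u v ⟩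
      ladj H (include r u) (include r v)          ≡⟨ proj₂ rep _ _ ⟩
      adj C (to (include r u)) (to (include r v)) ≡⟨ cong₂ (adj C) (embed-φ u) (embed-φ v) ⟨
      adj C (embed (φ u)) (embed (φ v))           ≡⟨ embed-adj (φ u) (φ v) ⟩
      adj G (φ u) (φ v)                           ∎

module _ {k : ℕ} {Ex : ℕ → Set} {ev : ∀ {N} → Ex N → LGraph k N}
         (restrict : ∀ {n} (e : Ex n) {P : Pred (Fin n) 0ℓ} → Decidable P → Restricted Ex ev (ev e) P) where

  open Inverse using (to; from; strictlyInverseˡ)
  open InducedSubgraph using (embed)

  expressible-induced : ∀ {G C} → InducedSubgraph G C → Fin (V G) → Expressible Ex ev C → Expressible Ex ev G
  expressible-induced G⊆C x₀ (_ , e , rep@(f , _)) with restrict e (λ u → any? λ x → embed G⊆C x ≟ to f u)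
  ... | empty ∉P        = contradiction (x₀ , sym (strictlyInverseˡ f y₀)) (∉P (from f y₀))
    where y₀ = embed G⊆C x₀
  ... | restricted e' r = _ , e' , restriction-represents G⊆C rep r

vertexCW : ∀ {k n} → CWExpr k n → Fin n
vertexCW (cw-vtx _)     = zero
vertexCW (cw-⊕ e _)     = vertexCW e ↑ˡ _
vertexCW (cw-ρ _ _ _ e) = vertexCW e
vertexCW (cw-η _ _ _ e) = vertexCW e

vertexNLC : ∀ {k n} → NLCExpr k n → Fin n
vertexNLC (nlc-vtx _)   = zero
vertexNLC (nlc-× _ e _) = vertexNLC e ↑ˡ _
vertexNLC (nlc-∘ _ e)   = vertexNLC e

InCW-vertex : ∀ {k} G → InCW k G → Fin (V G)
InCW-vertex _ (_ , e , f , _) = Inverse.to f (vertexCW e)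

InNLC-vertex : ∀ {k} G → InNLC k G → Fin (V G)
InNLC-vertex _ (_ , e , f , _) = Inverse.to f (vertexNLC e)

-- The corona

-- (i , nothing) is vertex i of G₁; (i , just j) is vertex j of the copy of G₂ attached to i.
CoronaVertex : ℕ → ℕ → Set
CoronaVertex n₁ n₂ = Fin n₁ × Maybe (Fin n₂)

coronaAdj : ∀ {n₁ n₂} → (Fin n₁ → Fin n₁ → Bool) → (Fin n₂ → Fin n₂ → Bool) →
            CoronaVertex n₁ n₂ → CoronaVertex n₁ n₂ → Bool
coronaAdj A₁ A₂ (i , nothing) (i' , nothing) = A₁ i i'
coronaAdj A₁ A₂ (i , nothing) (i' , just _)  = i == i'
coronaAdj A₁ A₂ (i , just _)  (i' , nothing) = i == i'
coronaAdj A₁ A₂ (i , just j)  (i' , just j') = (i == i') ∧ A₂ j j'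

coronaIndex : ∀ {n₁ n₂} → CoronaVertex n₁ n₂ ↔ Fin (n₁ + n₁ * n₂)
coronaIndex {n₁} {n₂} = mk↔ₛ′ to from to∘from from∘to
  where
  to : CoronaVertex n₁ n₂ → Fin (n₁ + n₁ * n₂)
  to (i , nothing) = i ↑ˡ (n₁ * n₂)
  to (i , just j)  = n₁ ↑ʳ combine i j

  from : Fin (n₁ + n₁ * n₂) → CoronaVertex n₁ n₂
  from u = [ (λ i → i , nothing) , (λ q → map₂ just (remQuot n₂ q)) ]′ (splitAt n₁ u)

  to∘from : ∀ u → to (from u) ≡ u
  to∘from = ↑-elim _ ˡ ʳ
    where
    ˡ : ∀ i → to (from (i ↑ˡ (n₁ * n₂))) ≡ i ↑ˡ (n₁ * n₂)
    ˡ i rewrite splitAt-↑ˡ n₁ i (n₁ * n₂) = refl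
    ʳ : ∀ q → to (from (n₁ ↑ʳ q)) ≡ n₁ ↑ʳ q
    ʳ q rewrite splitAt-↑ʳ n₁ (n₁ * n₂) q = cong (n₁ ↑ʳ_) (combine-remQuot {n₁} n₂ q)

  from∘to : ∀ p → from (to p) ≡ p
  from∘to (i , nothing) rewrite splitAt-↑ˡ n₁ i (n₁ * n₂) = refl
  from∘to (i , just j) rewrite splitAt-↑ʳ n₁ (n₁ * n₂) (combine i j) =
    cong (map₂ just) (remQuot-combine i j)

module _ (G₁ G₂ : Graph) where
  private
    n₁ = V G₁
    n₂ = V G₂

  corona-adj : ∀ p q → adj (corona G₁ G₂) (Inverse.to coronaIndex p) (Inverse.to coronaIndex q)
                       ≡ coronaAdj (adj G₁) (adj G₂) p q
  corona-adj (i , nothing) (i' , nothing)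
    rewrite splitAt-↑ˡ n₁ i (n₁ * n₂) | splitAt-↑ˡ n₁ i' (n₁ * n₂) = refl
  corona-adj (i , nothing) (i' , just j')
    rewrite splitAt-↑ˡ n₁ i (n₁ * n₂) | splitAt-↑ʳ n₁ (n₁ * n₂) (combine i' j') =
    cong ((i ==_) ∘ proj₁) (remQuot-combine i' j')
  corona-adj (i , just j) (i' , nothing)
    rewrite splitAt-↑ʳ n₁ (n₁ * n₂) (combine i j) | splitAt-↑ˡ n₁ i' (n₁ * n₂) =
    cong ((_== i') ∘ proj₁) (remQuot-combine i j)
  corona-adj (i , just j) (i' , just j')
    rewrite splitAt-↑ʳ n₁ (n₁ * n₂) (combine i j) | splitAt-↑ʳ n₁ (n₁ * n₂) (combine i' j') =
    cong₂ (λ (x , y) (x' , y') → (x == x') ∧ adj G₂ y y') (remQuot-combine i j) (remQuot-combine i' j')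

module _ (G₁ G₂ : Graph) where
  open Inverse (coronaIndex {V G₁} {V G₂}) using (to)
  open Injection (↔⇒↣ (coronaIndex {V G₁} {V G₂})) using (injective)

  corona-induced₁ : InducedSubgraph G₁ (corona G₁ G₂)
  corona-induced₁ = record
    { embed           = λ x → to (x , nothing)
    ; embed-injective = λ {x} {y} → cong proj₁ ∘ injective {x , nothing} {y , nothing}
    ; embed-adj       = λ x y → corona-adj G₁ G₂ (x , nothing) (y , nothing) }

  corona-induced₂ : Fin (V G₁) → InducedSubgraph G₂ (corona G₁ G₂)
  corona-induced₂ i = record
    { embed           = λ y → to (i , just y)
    ; embed-injective = just-injective ∘ cong proj₂ ∘ injective
    ; embed-adj       = λ y y' → trans (corona-adj G₁ G₂ (i , just y) (i , just y'))
                                       (cong (_∧ adj G₂ y y') (==-refl i)) }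

-- Attaching a cone to every leaf

liftCross : ∀ {m} → (Fin m → Fin m → Bool) → Fin (suc m) → Fin (suc m) → Bool
liftCross c (suc a) (suc b) = c a b
liftCross c _       _       = false

liftCross-flip : ∀ {m} (c : Fin m → Fin m → Bool) a b → liftCross (flip c) b a ≡ liftCross c a b
liftCross-flip c zero    zero    = refl
liftCross-flip c zero    (suc b) = refl
liftCross-flip c (suc a) zero    = refl
liftCross-flip c (suc a) (suc b) = refl

coronaLab : ∀ {m n n₂} → (Fin n → Fin m) → CoronaVertex n n₂ → Fin (suc m)
coronaLab L (x , nothing) = suc (L x)
coronaLab L (x , just _)  = zero

module _ {n₂ : ℕ} {A₂ : Fin n₂ → Fin n₂ → Bool} where

  coronaAdj-map₁ : ∀ {n n'} {A : Fin n → Fin n → Bool} {B : Fin n' → Fin n' → Bool} {g : Fin n → Fin n'} →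
                   Injective _≡_ _≡_ g → (∀ x x' → B (g x) (g x') ≡ A x x') →
                   ∀ p q → coronaAdj B A₂ (map₁ g p) (map₁ g q) ≡ coronaAdj A A₂ p q
  coronaAdj-map₁ g-inj B-g (x , nothing) (x' , nothing) = B-g x x'
  coronaAdj-map₁ g-inj B-g (x , nothing) (x' , just _)  = ==-map-injective g-inj x x'
  coronaAdj-map₁ g-inj B-g (x , just _)  (x' , nothing) = ==-map-injective g-inj x x'
  coronaAdj-map₁ g-inj B-g (x , just y)  (x' , just y') = cong (_∧ A₂ y y') (==-map-injective g-inj x x')

  coronaAdj-apart : ∀ {m n p q} {A : Fin n → Fin n → Bool} {c : Fin m → Fin m → Bool}
                    {g₁ : Fin p → Fin n} {g₂ : Fin q → Fin n} {L₁ : Fin p → Fin m} {L₂ : Fin q → Fin m} →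
                    (∀ x y → g₁ x ≢ g₂ y) → (∀ x y → A (g₁ x) (g₂ y) ≡ c (L₁ x) (L₂ y)) →
                    ∀ s t → coronaAdj A A₂ (map₁ g₁ s) (map₁ g₂ t) ≡ liftCross c (coronaLab L₁ s) (coronaLab L₂ t)
  coronaAdj-apart g₁≢g₂ A-c (x , nothing) (y , nothing) = A-c x y
  coronaAdj-apart g₁≢g₂ A-c (x , nothing) (y , just _)  = ==-≢ (g₁≢g₂ x y)
  coronaAdj-apart g₁≢g₂ A-c (x , just _)  (y , nothing) = ==-≢ (g₁≢g₂ x y)
  coronaAdj-apart g₁≢g₂ A-c (x , just _)  (y , just _)  = cong (_∧ _) (==-≢ (g₁≢g₂ x y))

coronaLab-map₁ : ∀ {m n n' n₂} {L : Fin n → Fin m} {L' : Fin n' → Fin m} {g : Fin n → Fin n'} →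
                 (∀ x → L' (g x) ≡ L x) → ∀ (p : CoronaVertex n n₂) → coronaLab L' (map₁ g p) ≡ coronaLab L p
coronaLab-map₁ L'-g (x , nothing) = cong suc (L'-g x)
coronaLab-map₁ L'-g (x , just _)  = refl

coronaLab-lift : ∀ {m n n₂} (R : Fin m → Fin m) (L : Fin n → Fin m) (p : CoronaVertex n n₂) →
                 lift 1 R (coronaLab L p) ≡ coronaLab (R ∘ L) p
coronaLab-lift R L (x , nothing) = refl
coronaLab-lift R L (x , just _)  = refl

coronaAdj-addEdges : ∀ {m n n₂} (A₂ : Fin n₂ → Fin n₂ → Bool) (H : LGraph m n) a b (p q : CoronaVertex n n₂) →
  let L = coronaLab (lab H) in
  (coronaAdj (ladj H) A₂ p q ∨ ((L p == suc a ∧ L q == suc b) ∨ (L p == suc b ∧ L q == suc a)))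
  ≡ coronaAdj (ladj (addEdges a b H)) A₂ p q
coronaAdj-addEdges A₂ H a b (x , nothing) (x' , nothing)
  rewrite ==-map-injective suc-injective (lab H x) a | ==-map-injective suc-injective (lab H x') b
        | ==-map-injective suc-injective (lab H x) b | ==-map-injective suc-injective (lab H x') a = refl
coronaAdj-addEdges A₂ H a b (x , nothing) (x' , just _)
  rewrite ∧-zeroʳ (suc (lab H x) == suc a) | ∧-zeroʳ (suc (lab H x) == suc b) = ∨-identityʳ _
coronaAdj-addEdges A₂ H a b (x , just _)  (x' , nothing) = ∨-identityʳ _
coronaAdj-addEdges A₂ H a b (x , just _)  (x' , just _)  = ∨-identityʳ _

record IsCoronaOf {m n N} (H : LGraph m n) (G₂ : Graph) (E : LGraph (suc m) N) : Set where
  field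
    position     : Fin N ↔ CoronaVertex n (V G₂)
  open Inverse position public using () renaming (to to pos)
  field
    adj-position : ∀ w w' → ladj E w w' ≡ coronaAdj (ladj H) (adj G₂) (pos w) (pos w')
    lab-position : ∀ w → lab E w ≡ coronaLab (lab H) (pos w)
open IsCoronaOf

record IsCone {m n₂} (a : Fin m) (G₂ : Graph) (Γ : LGraph (suc m) (suc n₂)) : Set where
  field
    base      : Fin n₂ ↔ Fin (V G₂)
    apex-apex : ladj Γ zero zero ≡ false
    apex-base : ∀ j → ladj Γ zero (suc j) ≡ true
    base-apex : ∀ j → ladj Γ (suc j) zero ≡ true
    base-base : ∀ j j' → ladj Γ (suc j) (suc j') ≡ adj G₂ (Inverse.to base j) (Inverse.to base j')
    apex-lab  : lab Γ zero ≡ suc a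
    base-lab  : ∀ j → lab Γ (suc j) ≡ zero

isCoronaOf-cone : ∀ {m n₂} {a : Fin m} {G₂} {Γ : LGraph (suc m) (suc n₂)} → IsCone a G₂ Γ → IsCoronaOf (single a) G₂ Γ
isCoronaOf-cone {n₂ = n₂} {a} {G₂} {Γ} cone = record
  { position     = mk↔ₛ′ to from to∘from from∘to
  ; adj-position = adjacency
  ; lab-position = λ { zero → apex-lab ; (suc j) → base-lab j } }
  where
  open IsCone cone
  to : Fin (suc n₂) → CoronaVertex 1 (V G₂)
  to zero    = zero , nothing
  to (suc j) = zero , just (Inverse.to base j)
  from : CoronaVertex 1 (V G₂) → Fin (suc n₂)
  from (zero , nothing) = zero
  from (zero , just y)  = suc (Inverse.from base y)
  to∘from : ∀ p → to (from p) ≡ p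
  to∘from (zero , nothing) = refl
  to∘from (zero , just y)  = cong (λ y → zero , just y) (Inverse.strictlyInverseˡ base y)
  from∘to : ∀ w → from (to w) ≡ w
  from∘to zero    = refl
  from∘to (suc j) = cong suc (Inverse.strictlyInverseʳ base j)
  adjacency : ∀ w w' → ladj Γ w w' ≡ coronaAdj (ladj (single a)) (adj G₂) (to w) (to w')
  adjacency zero    zero     = apex-apex
  adjacency zero    (suc j)  = apex-base j
  adjacency (suc j) zero     = base-apex j
  adjacency (suc j) (suc j') = base-base j j'

module _ {m : ℕ} {G₂ : Graph} where

  isCoronaOf-union : ∀ {p q N₁ N₂} {c : Fin m → Fin m → Bool} {c' : Fin (suc m) → Fin (suc m) → Bool}
                     {H₁ : LGraph m p} {H₂ : LGraph m q} {E₁ : LGraph (suc m) N₁} {E₂ : LGraph (suc m) N₂} →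
                     (∀ a b → c' a b ≡ liftCross c a b) →
                     IsCoronaOf H₁ G₂ E₁ → IsCoronaOf H₂ G₂ E₂ →
                     IsCoronaOf (unionWith c H₁ H₂) G₂ (unionWith c' E₁ E₂)
  isCoronaOf-union {p} {q} {N₁} {N₂} {c} {c'} {H₁} {H₂} {E₁} {E₂} c'-lift ρ₁ ρ₂ = record
    { position     = position₁₂
    ; adj-position = ↑-elim _ (λ i → ↑-elim _ (ˡˡ i) (ˡʳ i)) (λ j → ↑-elim _ (ʳˡ j) (ʳʳ j))
    ; lab-position = ↑-elim _ labˡ labʳ }
    where
    open ≡-Reasoning
    H = unionWith c H₁ H₂
    E = unionWith c' E₁ E₂
    C = coronaAdj (ladj H) (adj G₂)

    position₁₂ : Fin (N₁ + N₂) ↔ CoronaVertex (p + q) (V G₂)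
    position₁₂ = ↔-trans +↔⊎ (↔-trans (position ρ₁ ⊎-↔ position ρ₂)
                                      (↔-trans (↔-sym ×-distribʳ-⊎) (↔-sym +↔⊎ ×-↔ ↔-refl)))
    pos₁₂ = Inverse.to position₁₂

    posˡ : ∀ i → pos₁₂ (i ↑ˡ N₂) ≡ map₁ (_↑ˡ q) (pos ρ₁ i)
    posˡ i rewrite splitAt-↑ˡ N₁ i N₂ = refl
    posʳ : ∀ j → pos₁₂ (N₁ ↑ʳ j) ≡ map₁ (p ↑ʳ_) (pos ρ₂ j)
    posʳ j rewrite splitAt-↑ʳ N₁ N₂ j = refl

    ˡˡ : ∀ i i' → ladj E (i ↑ˡ N₂) (i' ↑ˡ N₂) ≡ C (pos₁₂ (i ↑ˡ N₂)) (pos₁₂ (i' ↑ˡ N₂))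
    ˡˡ i i' = begin
      ladj E (i ↑ˡ N₂) (i' ↑ˡ N₂)                              ≡⟨ unionWith-ˡˡ c' E₁ E₂ i i' ⟩
      ladj E₁ i i'                                            ≡⟨ adj-position ρ₁ i i' ⟩
      coronaAdj (ladj H₁) (adj G₂) (pos ρ₁ i) (pos ρ₁ i')      ≡⟨ coronaAdj-map₁ {B = ladj H} (↑ˡ-injective q _ _) (unionWith-ˡˡ c H₁ H₂) (pos ρ₁ i) (pos ρ₁ i') ⟨
      C (map₁ (_↑ˡ q) (pos ρ₁ i)) (map₁ (_↑ˡ q) (pos ρ₁ i'))   ≡⟨ cong₂ C (posˡ i) (posˡ i') ⟨
      C (pos₁₂ (i ↑ˡ N₂)) (pos₁₂ (i' ↑ˡ N₂))                  ∎

    ʳʳ : ∀ j j' → ladj E (N₁ ↑ʳ j) (N₁ ↑ʳ j') ≡ C (pos₁₂ (N₁ ↑ʳ j)) (pos₁₂ (N₁ ↑ʳ j'))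
    ʳʳ j j' = begin
      ladj E (N₁ ↑ʳ j) (N₁ ↑ʳ j')                              ≡⟨ unionWith-ʳʳ c' E₁ E₂ j j' ⟩
      ladj E₂ j j'                                            ≡⟨ adj-position ρ₂ j j' ⟩
      coronaAdj (ladj H₂) (adj G₂) (pos ρ₂ j) (pos ρ₂ j')      ≡⟨ coronaAdj-map₁ {B = ladj H} (↑ʳ-injective p _ _) (unionWith-ʳʳ c H₁ H₂) (pos ρ₂ j) (pos ρ₂ j') ⟨
      C (map₁ (p ↑ʳ_) (pos ρ₂ j)) (map₁ (p ↑ʳ_) (pos ρ₂ j'))   ≡⟨ cong₂ C (posʳ j) (posʳ j') ⟨
      C (pos₁₂ (N₁ ↑ʳ j)) (pos₁₂ (N₁ ↑ʳ j'))                  ∎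

    cross : ∀ i j → c' (lab E₁ i) (lab E₂ j)
                    ≡ liftCross c (coronaLab (lab H₁) (pos ρ₁ i)) (coronaLab (lab H₂) (pos ρ₂ j))
    cross i j = trans (c'-lift _ _) (cong₂ (liftCross c) (lab-position ρ₁ i) (lab-position ρ₂ j))

    ˡʳ : ∀ i j → ladj E (i ↑ˡ N₂) (N₁ ↑ʳ j) ≡ C (pos₁₂ (i ↑ˡ N₂)) (pos₁₂ (N₁ ↑ʳ j))
    ˡʳ i j = begin
      ladj E (i ↑ˡ N₂) (N₁ ↑ʳ j)                               ≡⟨ unionWith-ˡʳ c' E₁ E₂ i j ⟩
      c' (lab E₁ i) (lab E₂ j)                                ≡⟨ cross i j ⟩
      liftCross c (coronaLab (lab H₁) (pos ρ₁ i)) (coronaLab (lab H₂) (pos ρ₂ j))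
        ≡⟨ coronaAdj-apart {A = ladj H} ↑ˡ≢↑ʳ (unionWith-ˡʳ c H₁ H₂) (pos ρ₁ i) (pos ρ₂ j) ⟨
      C (map₁ (_↑ˡ q) (pos ρ₁ i)) (map₁ (p ↑ʳ_) (pos ρ₂ j))    ≡⟨ cong₂ C (posˡ i) (posʳ j) ⟨
      C (pos₁₂ (i ↑ˡ N₂)) (pos₁₂ (N₁ ↑ʳ j))                   ∎

    ʳˡ : ∀ j i → ladj E (N₁ ↑ʳ j) (i ↑ˡ N₂) ≡ C (pos₁₂ (N₁ ↑ʳ j)) (pos₁₂ (i ↑ˡ N₂))
    ʳˡ j i = begin
      ladj E (N₁ ↑ʳ j) (i ↑ˡ N₂)                               ≡⟨ unionWith-ʳˡ c' E₁ E₂ j i ⟩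
      c' (lab E₁ i) (lab E₂ j)                                ≡⟨ cross i j ⟩
      liftCross c (coronaLab (lab H₁) (pos ρ₁ i)) (coronaLab (lab H₂) (pos ρ₂ j))
        ≡⟨ liftCross-flip c (coronaLab (lab H₁) (pos ρ₁ i)) (coronaLab (lab H₂) (pos ρ₂ j)) ⟨
      liftCross (flip c) (coronaLab (lab H₂) (pos ρ₂ j)) (coronaLab (lab H₁) (pos ρ₁ i))
        ≡⟨ coronaAdj-apart {A = ladj H} (λ y x → ↑ˡ≢↑ʳ x y ∘ sym) (unionWith-ʳˡ c H₁ H₂) (pos ρ₂ j) (pos ρ₁ i) ⟨
      C (map₁ (p ↑ʳ_) (pos ρ₂ j)) (map₁ (_↑ˡ q) (pos ρ₁ i))    ≡⟨ cong₂ C (posʳ j) (posˡ i) ⟨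
      C (pos₁₂ (N₁ ↑ʳ j)) (pos₁₂ (i ↑ˡ N₂))                   ∎

    labˡ : ∀ i → lab E (i ↑ˡ N₂) ≡ coronaLab (lab H) (pos₁₂ (i ↑ˡ N₂))
    labˡ i = begin
      lab E (i ↑ˡ N₂)                              ≡⟨ unionWith-labˡ c' E₁ E₂ i ⟩
      lab E₁ i                                    ≡⟨ lab-position ρ₁ i ⟩
      coronaLab (lab H₁) (pos ρ₁ i)                ≡⟨ coronaLab-map₁ {L' = lab H} (unionWith-labˡ c H₁ H₂) (pos ρ₁ i) ⟨
      coronaLab (lab H) (map₁ (_↑ˡ q) (pos ρ₁ i))  ≡⟨ cong (coronaLab (lab H)) (posˡ i) ⟨
      coronaLab (lab H) (pos₁₂ (i ↑ˡ N₂))          ∎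

    labʳ : ∀ j → lab E (N₁ ↑ʳ j) ≡ coronaLab (lab H) (pos₁₂ (N₁ ↑ʳ j))
    labʳ j = begin
      lab E (N₁ ↑ʳ j)                              ≡⟨ unionWith-labʳ c' E₁ E₂ j ⟩
      lab E₂ j                                    ≡⟨ lab-position ρ₂ j ⟩
      coronaLab (lab H₂) (pos ρ₂ j)                ≡⟨ coronaLab-map₁ {L' = lab H} (unionWith-labʳ c H₁ H₂) (pos ρ₂ j) ⟨
      coronaLab (lab H) (map₁ (p ↑ʳ_) (pos ρ₂ j))  ≡⟨ cong (coronaLab (lab H)) (posʳ j) ⟨
      coronaLab (lab H) (pos₁₂ (N₁ ↑ʳ j))          ∎

  module _ {n N : ℕ} {H : LGraph m n} {E : LGraph (suc m) N} (ρ : IsCoronaOf H G₂ E) where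

    isCoronaOf-relabel : ∀ R {R'} → (∀ a → R' a ≡ lift 1 R a) → IsCoronaOf (relabel R H) G₂ (relabel R' E)
    isCoronaOf-relabel R {R'} R'-lift = record
      { position     = position ρ
      ; adj-position = adj-position ρ
      ; lab-position = λ w → begin
          R' (lab E w)                      ≡⟨ R'-lift (lab E w) ⟩
          lift 1 R (lab E w)                ≡⟨ cong (lift 1 R) (lab-position ρ w) ⟩
          lift 1 R (coronaLab (lab H) (pos ρ w)) ≡⟨ coronaLab-lift R (lab H) (pos ρ w) ⟩
          coronaLab (R ∘ lab H) (pos ρ w)   ∎ }
      where open ≡-Reasoning

    isCoronaOf-addEdges : ∀ a b → IsCoronaOf (addEdges a b H) G₂ (addEdges (suc a) (suc b) E)
    isCoronaOf-addEdges a b = record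
      { position     = position ρ
      ; adj-position = adjacency
      ; lab-position = lab-position ρ }
      where
      adjacency : ∀ w w' → ladj (addEdges (suc a) (suc b) E) w w'
                           ≡ coronaAdj (ladj (addEdges a b H)) (adj G₂) (pos ρ w) (pos ρ w')
      adjacency w w' rewrite adj-position ρ w w' | lab-position ρ w | lab-position ρ w' =
        coronaAdj-addEdges (adj G₂) H a b (pos ρ w) (pos ρ w')

represents-corona : ∀ {m n N} {H : LGraph m n} {E : LGraph (suc m) N} {G₁ G₂} →
                    IsCoronaOf H G₂ E → Represents H G₁ → Represents E (corona G₁ G₂)
represents-corona {H = H} {E} {G₁} {G₂} ρ (f₁ , f₁-adj) =
  coronaIndex ↔-∘ ((f₁ ×-↔ ↔-refl) ↔-∘ position ρ) , adjacency
  where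
  open ≡-Reasoning
  to₁ = Inverse.to f₁
  adjacency : ∀ w w' → ladj E w w' ≡ adj (corona G₁ G₂) (Inverse.to coronaIndex (map₁ to₁ (pos ρ w)))
                                                        (Inverse.to coronaIndex (map₁ to₁ (pos ρ w')))
  adjacency w w' = begin
    ladj E w w'                                                        ≡⟨ adj-position ρ w w' ⟩
    coronaAdj (ladj H) (adj G₂) (pos ρ w) (pos ρ w')
      ≡⟨ coronaAdj-map₁ (Injection.injective (↔⇒↣ f₁)) (λ x x' → sym (f₁-adj x x')) (pos ρ w) (pos ρ w') ⟨
    coronaAdj (adj G₁) (adj G₂) (map₁ to₁ (pos ρ w)) (map₁ to₁ (pos ρ w')) ≡⟨ corona-adj G₁ G₂ (map₁ to₁ (pos ρ w)) (map₁ to₁ (pos ρ w')) ⟨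
    adj (corona G₁ G₂) (Inverse.to coronaIndex (map₁ to₁ (pos ρ w))) (Inverse.to coronaIndex (map₁ to₁ (pos ρ w'))) ∎

-- ρ renames a single label, so the base of a cone is moved to label 0 one label at a time.
collapseToZero : ∀ {m n} → List (Fin m) → CWExpr (suc m) n → CWExpr (suc m) n
collapseToZero []       e = e
collapseToZero (c ∷ cs) e = collapseToZero cs (cw-ρ (suc c) zero (λ ()) e)

collapse : ∀ {m} → List (Fin m) → Fin (suc m) → Fin (suc m)
collapse []       l = l
collapse (c ∷ cs) l = collapse cs (replace (suc c) zero l)

collapseToZero-adj : ∀ {m n} cs (e : CWExpr (suc m) n) u v →
                     ladj (evalCW (collapseToZero cs e)) u v ≡ ladj (evalCW e) u v
collapseToZero-adj []       e u v = refl
collapseToZero-adj (c ∷ cs) e u v = collapseToZero-adj cs _ u v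

collapseToZero-lab : ∀ {m n} cs (e : CWExpr (suc m) n) u →
                     lab (evalCW (collapseToZero cs e)) u ≡ collapse cs (lab (evalCW e) u)
collapseToZero-lab []       e u = refl
collapseToZero-lab (c ∷ cs) e u = collapseToZero-lab cs _ u

collapse-zero : ∀ {m} (cs : List (Fin m)) → collapse cs zero ≡ zero
collapse-zero []       = refl
collapse-zero (c ∷ cs) = collapse-zero cs

collapse-suc : ∀ {m} {x : Fin m} {cs} → x ∈ cs → collapse cs (suc x) ≡ zero
collapse-suc {x = x} {c ∷ cs} (here refl) rewrite ==-refl (suc x) = collapse-zero cs
collapse-suc {x = x} {c ∷ cs} (there x∈cs) with suc x == suc c
... | true  = collapse-zero cs
... | false = collapse-suc x∈cs

module CoronaCW {m n₂ : ℕ} {G₂ : Graph} (e₂ : CWExpr m n₂) (rep₂ : Represents (evalCW e₂) G₂) where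
  open Σ rep₂ renaming (proj₁ to f₂; proj₂ to f₂-adj)

  base : CWExpr (suc m) n₂
  base = collapseToZero (allFin m) (liftCW suc-injective e₂)

  base-lab : ∀ j → lab (evalCW base) j ≡ zero
  base-lab j = begin
    lab (evalCW base) j                                  ≡⟨ collapseToZero-lab (allFin m) _ j ⟩
    collapse (allFin m) (lab (evalCW (liftCW suc-injective e₂)) j)
      ≡⟨ cong (collapse (allFin m)) (lab-pullback (liftCW-pullback suc-injective e₂) j) ⟩
    collapse (allFin m) (suc (lab (evalCW e₂) j))       ≡⟨ collapse-suc (∈-allFin _) ⟩
    zero                                                 ∎
    where open ≡-Reasoning

  base-adj : ∀ j j' → ladj (evalCW base) j j' ≡ adj G₂ (Inverse.to f₂ j) (Inverse.to f₂ j')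
  base-adj j j' = trans (collapseToZero-adj (allFin m) _ j j')
                        (trans (adj-pullback (liftCW-pullback suc-injective e₂) j j') (f₂-adj j j'))

  cone : Fin m → CWExpr (suc m) (suc n₂)
  cone a = cw-η (suc a) zero (λ ()) (cw-⊕ (cw-vtx (suc a)) base)

  cone-isCone : ∀ a → IsCone a G₂ (evalCW (cone a))
  cone-isCone a = record
    { base      = f₂
    ; apex-apex = apex-apex
    ; apex-base = apex-base
    ; base-apex = base-apex
    ; base-base = base-base
    ; apex-lab  = refl
    ; base-lab  = base-lab }
    where
    Γ = evalCW (cone a)
    apex-apex : ladj Γ zero zero ≡ false
    apex-apex rewrite ==-refl (suc a) = refl
    apex-base : ∀ j → ladj Γ zero (suc j) ≡ true
    apex-base j rewrite ==-refl (suc a) | base-lab j = refl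
    base-apex : ∀ j → ladj Γ (suc j) zero ≡ true
    base-apex j rewrite ==-refl (suc a) | base-lab j = refl
    base-base : ∀ j j' → ladj Γ (suc j) (suc j') ≡ adj G₂ (Inverse.to f₂ j) (Inverse.to f₂ j')
    base-base j j' rewrite base-lab j | base-lab j' = trans (∨-identityʳ _) (base-adj j j')

  attachCones : ∀ {n} → CWExpr m n → ∃ (CWExpr (suc m))
  attachCones (cw-vtx a)       = _ , cone a
  attachCones (cw-⊕ e f)       = _ , cw-⊕ (proj₂ (attachCones e)) (proj₂ (attachCones f))
  attachCones (cw-ρ a b a≢b e) = _ , cw-ρ (suc a) (suc b) (a≢b ∘ suc-injective) (proj₂ (attachCones e))
  attachCones (cw-η a b a≢b e) = _ , cw-η (suc a) (suc b) (a≢b ∘ suc-injective) (proj₂ (attachCones e))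

  attachCones-isCoronaOf : ∀ {n} (e : CWExpr m n) → IsCoronaOf (evalCW e) G₂ (evalCW (proj₂ (attachCones e)))
  attachCones-isCoronaOf (cw-vtx a)     = isCoronaOf-cone (cone-isCone a)
  attachCones-isCoronaOf (cw-⊕ e f)     =
    isCoronaOf-union no-edges (attachCones-isCoronaOf e) (attachCones-isCoronaOf f)
    where
    no-edges : ∀ a b → false ≡ liftCross (λ _ _ → false) a b
    no-edges zero    _       = refl
    no-edges (suc a) zero    = refl
    no-edges (suc a) (suc b) = refl
  attachCones-isCoronaOf (cw-ρ a b _ e) =
    isCoronaOf-relabel (attachCones-isCoronaOf e) (replace a b) replace-lift
    where
    replace-lift : ∀ c → replace (suc a) (suc b) c ≡ lift 1 (replace a b) c
    replace-lift zero    = refl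
    replace-lift (suc c) = replace-map-injective suc-injective a b c
  attachCones-isCoronaOf (cw-η a b _ e) = isCoronaOf-addEdges (attachCones-isCoronaOf e) a b

module CoronaNLC {m n₂ : ℕ} {G₂ : Graph} (e₂ : NLCExpr m n₂) (rep₂ : Represents (evalNLC e₂) G₂) where
  open Σ rep₂ renaming (proj₁ to f₂; proj₂ to f₂-adj)

  unsuc : Fin (suc m) → Maybe (Fin m)
  unsuc zero    = nothing
  unsuc (suc a) = just a

  base : NLCExpr (suc m) n₂
  base = nlc-∘ (const zero) (liftNLC unsuc (λ _ → refl) e₂)

  cone : Fin m → NLCExpr (suc m) (suc n₂)
  cone a = nlc-× (λ _ _ → true) (nlc-vtx (suc a)) base

  cone-isCone : ∀ a → IsCone a G₂ (evalNLC (cone a))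
  cone-isCone a = record
    { base      = f₂
    ; apex-apex = refl
    ; apex-base = λ _ → refl
    ; base-apex = λ _ → refl
    ; base-base = λ j j' → trans (adj-pullback (liftNLC-pullback unsuc (λ _ → refl) e₂) j j') (f₂-adj j j')
    ; apex-lab  = refl
    ; base-lab  = λ _ → refl }

  attachCones : ∀ {n} → NLCExpr m n → ∃ (NLCExpr (suc m))
  attachCones (nlc-vtx a)   = _ , cone a
  attachCones (nlc-× S e f) = _ , nlc-× (liftCross S) (proj₂ (attachCones e)) (proj₂ (attachCones f))
  attachCones (nlc-∘ R e)   = _ , nlc-∘ (lift 1 R) (proj₂ (attachCones e))

  attachCones-isCoronaOf : ∀ {n} (e : NLCExpr m n) → IsCoronaOf (evalNLC e) G₂ (evalNLC (proj₂ (attachCones e)))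
  attachCones-isCoronaOf (nlc-vtx a)   = isCoronaOf-cone (cone-isCone a)
  attachCones-isCoronaOf (nlc-× S e f) =
    isCoronaOf-union (λ _ _ → refl) (attachCones-isCoronaOf e) (attachCones-isCoronaOf f)
  attachCones-isCoronaOf (nlc-∘ R e)   = isCoronaOf-relabel (attachCones-isCoronaOf e) R (λ _ → refl)

InCW-corona : ∀ {m G₁ G₂} → InCW m G₁ → InCW m G₂ → InCW (suc m) (corona G₁ G₂)
InCW-corona {G₂ = G₂} (_ , e₁ , rep₁) (_ , e₂ , rep₂) =
  _ , proj₂ (attachCones e₁) , represents-corona (attachCones-isCoronaOf e₁) rep₁
  where open CoronaCW {G₂ = G₂} e₂ rep₂

InNLC-corona : ∀ {m G₁ G₂} → InNLC m G₁ → InNLC m G₂ → InNLC (suc m) (corona G₁ G₂)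
InNLC-corona {G₂ = G₂} (_ , e₁ , rep₁) (_ , e₂ , rep₂) =
  _ , proj₂ (attachCones e₁) , represents-corona (attachCones-isCoronaOf e₁) rep₁
  where open CoronaNLC {G₂ = G₂} e₂ rep₂

-- The width bounds

Least : (ℕ → Set) → ℕ → Set
Least P k = P k × (∀ j → P j → k ≤ j)

module CoronaWidth
  (Has         : ℕ → Graph → Set)
  (has-mono    : ∀ {k k'} G → k ≤ k' → Has k G → Has k' G)
  (has-vertex  : ∀ {k} G → Has k G → Fin (V G))
  (has-induced : ∀ {k G C} → InducedSubgraph G C → Fin (V G) → Has k C → Has k G)
  (has-corona  : ∀ {k G₁ G₂} → Has k G₁ → Has k G₂ → Has (suc k) (corona G₁ G₂))
  where

  width-corona : ∀ {G₁ G₂ a₁ a₂ a} →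
                 Least (λ k → Has k G₁) a₁ → Least (λ k → Has k G₂) a₂ → Least (λ k → Has k (corona G₁ G₂)) a →
                 a₁ ⊔ a₂ ≤ a × a ≤ suc (a₁ ⊔ a₂)
  width-corona {G₁} {G₂} {a₁} {a₂} {a} (has₁ , least₁) (has₂ , least₂) (has , least) = lower , upper
    where
    i₀ = has-vertex G₁ has₁
    lower : a₁ ⊔ a₂ ≤ a
    lower = ⊔-lub (least₁ a (has-induced (corona-induced₁ G₁ G₂) i₀ has))
                  (least₂ a (has-induced (corona-induced₂ G₁ G₂ i₀) (has-vertex G₂ has₂) has))
    upper : a ≤ suc (a₁ ⊔ a₂)
    upper = least (suc (a₁ ⊔ a₂)) (has-corona (has-mono G₁ (m≤m⊔n a₁ a₂) has₁) (has-mono G₂ (m≤n⊔m a₁ a₂) has₂))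

theorem2 : (G₁ G₂ : Graph) → IsSimple G₁ → IsSimple G₂ →
    (∀ a₁ a₂ a → IsNLCW G₁ a₁ → IsNLCW G₂ a₂ → IsNLCW (corona G₁ G₂) a →
      (a₁ ⊔ a₂) ≤ a × a ≤ suc (a₁ ⊔ a₂)) ×
    (∀ b₁ b₂ b → IsCW G₁ b₁ → IsCW G₂ b₂ → IsCW (corona G₁ G₂) b →
      (b₁ ⊔ b₂) ≤ b × b ≤ suc (b₁ ⊔ b₂))
theorem2 G₁ G₂ _ _ = (λ _ _ _ → NLC.width-corona) , (λ _ _ _ → CW.width-corona)
  where
  module NLC = CoronaWidth (λ k G → InNLC k G) InNLC-mono InNLC-vertex
                           (expressible-induced restrictNLC) InNLC-corona
  module CW  = CoronaWidth (λ k G → InCW k G) InCW-mono InCW-vertex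
                           (expressible-induced restrictCW) InCW-corona
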